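{- Let $t$ be the Thue–Morse word, the fixed point starting with $a$ of the morphism $a\mapsto abba$, $b\mapsto baab$. The integer sequence $(PPL_t(n))_{n\ge 0}$ is $4$-regular.
   Context: $PPL_t(n)$ is the minimal number of palindromes whose concatenation is the prefix of $t$ of length $n$, with $PPL_t(0)=0$. A sequence $(a(n))_{n\ge0}$ of integers is $k$-regular if there exist finitely many integer sequences $(a_1(n)),\dots,(a_s(n))$ such that for every $i\ge 0$ and every $0\le b<k^i$ there exist integers $c_1,\dots,c_s$ with $a(k^in+b)=\sum_{j=1}^s c_j a_j(n)$ for all $n\ge 0$. -}

module Defs where

open import Data.Nat using (ℕ; zero; suc; _≤_; _<_; _^_) renaming (_+_ to _+ℕ_; _*_ to _*ℕ_)
open import Data.Integer using (ℤ) renaming (_+_ to _+ℤ_; _*_ to _*ℤ_)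
import Data.Integer as ℤ
open import Data.Fin using (Fin)
open import Data.List using (List; []; _∷_; concatMap; concat; take; length; reverse)
open import Data.List.Relation.Unary.All using (All)
open import Data.Product using (Σ; _×_; ∃)
open import Relation.Binary.PropositionalEquality using (_≡_; _≢_)

data Letter : Set where
  a b : Letter

μ₁ : Letter → List Letter
μ₁ a = a ∷ b ∷ b ∷ a ∷ []
μ₁ b = b ∷ a ∷ a ∷ b ∷ []

μ : List Letter → List Letter
μ = concatMap μ₁

μ^ : ℕ → List Letter
μ^ zero = a ∷ []
μ^ (suc k) = μ (μ^ k)

-- Since μ^k(a) is a prefix of t of length 4^k ≥ k,
-- the prefix of length n of t is the prefix of length n of μ^n(a).
tPrefix : ℕ → List Letter
tPrefix n = take n (μ^ n)

Palindrome : List Letter → Set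
Palindrome w = (w ≢ []) × (reverse w ≡ w)

PalFact : ℕ → ℕ → Set
PalFact n k = Σ (List (List Letter)) λ ws →
  All Palindrome ws × concat ws ≡ tPrefix n × length ws ≡ k

IsPPL : ℕ → ℕ → Set
IsPPL n k = PalFact n k × (∀ k′ → PalFact n k′ → k ≤ k′)

sumFin : (s : ℕ) → (Fin s → ℤ) → ℤ
sumFin zero f = ℤ.+ 0
sumFin (suc s) f = f Fin.zero +ℤ sumFin s (λ j → f (Fin.suc j))
  where import Data.Fin as Fin

Regular : ℕ → (ℕ → ℤ) → Set
Regular k u = Σ ℕ λ s → Σ (Fin s → ℕ → ℤ) λ as →
  ∀ (i : ℕ) (r : ℕ) → r < k ^ i →
    Σ (Fin s → ℤ) λ c → ∀ (n : ℕ) →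
      u ((k ^ i) *ℕ n +ℕ r) ≡ sumFin s (λ j → c j *ℤ as j n)

module Submission where

-- (1) The recurrence  f (4q) = f q,  f (4q+1) = f q + 1,
--     f (4q+2) = 2 + min (f q) (f (q+1)),  f (4q+3) = f (q+1) + 1.
--     After arithmetic preliminaries, t is described letter by letter (tm)
--     through its 4-adic and binary self-similarity.  Palindromic factors
--     u[j,m) of any sequence u are described pointwise (PalAt).  For t this
--     gives which palindromes occur: μ-images of palindromes are palindromes
--     and conversely, odd palindromes have length ≤ 3, and no palindrome is
--     centred inside a block t(2e) t(2e+1).  Appending a palindrome costs one
--     (ppl-append) and an optimal factorisation ends with a palindrome t[j,m)
--     with f j + 1 ≤ f m (ppl-last); strong induction on m then gives both
--     inequalities of the recurrence (upper, lower, recurrence).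
-- (2) Consecutive values of f differ by at most one, so each n has a slope in
--     {down, flat, up}.  By the recurrence, f (4m+r) − f m and the slope at
--     4m+r depend only on r and the slope at m (block-step, digit-step), so
--     f (4ⁱ n + r) = f n + G (slope n) (digits-step); such a sequence is
--     regular, generated by f and the three slope indicators
--     (regular-by-slopes).

open import Defs
open import Data.Nat using (ℕ; zero; suc; pred; _+_; _*_; _∸_; _^_; _≤_; _<_; _⊓_; z≤n; s≤s; _<?_)
open import Data.Nat.Properties
open import Data.Nat.Induction using (<-rec)
open import Data.Nat.Tactic.RingSolver using (solve-∀)
open import Data.Integer using (ℤ; +_) renaming (_+_ to _+ℤ_; _*_ to _*ℤ_)
import Data.Integer.Properties as ℤ
open import Data.Fin using (Fin) renaming (zero to fz; suc to fs)
open import Data.List using (List; []; _∷_; _++_; length; map; take; reverse; concat; _∷ʳ_; initLast; _∷ʳ′_)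
open import Data.List.Properties using (length-++; concatMap-++; ∷-injective; ∷ʳ-injective; reverse-++; unfold-reverse; ++-identityʳ; concat-++)
open import Data.List.Relation.Unary.All using (All)
open import Data.List.Relation.Unary.All.Properties using (∷ʳ⁺; ∷ʳ⁻)
open import Data.Product using (Σ; _×_; _,_; proj₁; proj₂)
open import Data.Sum using (_⊎_; inj₁; inj₂)
open import Data.Empty using (⊥; ⊥-elim)
open import Relation.Nullary using (yes; no)
open import Relation.Binary.PropositionalEquality

data Mod4 : ℕ → Set where
  r0 : ∀ q → Mod4 (4 * q + 0)
  r1 : ∀ q → Mod4 (4 * q + 1)
  r2 : ∀ q → Mod4 (4 * q + 2)
  r3 : ∀ q → Mod4 (4 * q + 3)

mod4 : ∀ n → Mod4 n
mod4 zero = r0 0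
mod4 (suc n) with mod4 n
... | r0 q = subst Mod4 (next0 q) (r1 q)
  where
  next0 : ∀ q → 4 * q + 1 ≡ suc (4 * q + 0)
  next0 = solve-∀
... | r1 q = subst Mod4 (next1 q) (r2 q)
  where
  next1 : ∀ q → 4 * q + 2 ≡ suc (4 * q + 1)
  next1 = solve-∀
... | r2 q = subst Mod4 (next2 q) (r3 q)
  where
  next2 : ∀ q → 4 * q + 3 ≡ suc (4 * q + 2)
  next2 = solve-∀
... | r3 q = subst Mod4 (next3 q) (r0 (suc q))
  where
  next3 : ∀ q → 4 * suc q + 0 ≡ suc (4 * q + 3)
  next3 = solve-∀

0<4 : 0 < 4
0<4 = s≤s z≤n
1<4 : 1 < 4
1<4 = s≤s (s≤s z≤n)
2<4 : 2 < 4
2<4 = s≤s (s≤s (s≤s z≤n))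
3<4 : 3 < 4
3<4 = s≤s (s≤s (s≤s (s≤s z≤n)))

divMod4 : ∀ n → Σ ℕ λ q → Σ ℕ λ r → (r < 4) × (n ≡ 4 * q + r)
divMod4 n with mod4 n
... | r0 q = q , 0 , 0<4 , refl
... | r1 q = q , 1 , 1<4 , refl
... | r2 q = q , 2 , 2<4 , refl
... | r3 q = q , 3 , 3<4 , refl

data Parity : ℕ → Set where
  even : ∀ q → Parity (2 * q)
  odd : ∀ q → Parity (2 * q + 1)

parity : ∀ n → Parity n
parity zero = even 0
parity (suc n) with parity n
... | even q = subst Parity (next0 q) (odd q)
  where
  next0 : ∀ q → 2 * q + 1 ≡ suc (2 * q)
  next0 = solve-∀
... | odd q = subst Parity (next1 q) (even (suc q))
  where
  next1 : ∀ q → 2 * suc q ≡ suc (2 * q + 1)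
  next1 = solve-∀

4*-suc : ∀ u t → 4 * suc u + t ≡ 4 + (4 * u + t)
4*-suc u t = trans (cong (_+ t) (*-suc 4 u)) (+-assoc 4 (4 * u) t)

divMod4-unique : ∀ u v r s → r < 4 → s < 4 → 4 * u + r ≡ 4 * v + s → (u ≡ v) × (r ≡ s)
divMod4-unique zero zero r s _ _ e = refl , e
divMod4-unique zero (suc v) r s r<4 _ e =
  ⊥-elim (<⇒≢ (≤-trans r<4 (≤-trans (m≤m+n 4 (4 * v + s)) (≤-reflexive (sym (4*-suc v s))))) e)
divMod4-unique (suc u) zero r s _ s<4 e =
  ⊥-elim (<⇒≢ (≤-trans s<4 (≤-trans (m≤m+n 4 (4 * u + r)) (≤-reflexive (sym (4*-suc u r))))) (sym e))
divMod4-unique (suc u) (suc v) r s r<4 s<4 e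
  with divMod4-unique u v r s r<4 s<4 (+-cancelˡ-≡ 4 _ _ (trans (sym (4*-suc u r)) (trans e (4*-suc v s))))
... | refl , r≡s = refl , r≡s

quot-mono : ∀ j u r → r < 4 → 4 * j + 0 ≤ 4 * u + r → j ≤ u
quot-mono j u r r<4 le with ≤-<-connex j u
... | inj₁ j≤u = j≤u
... | inj₂ u<j = ⊥-elim (<⇒≱ (<-≤-trans (+-monoʳ-< (4 * u) r<4) (≤-trans (≤-reflexive (sym (trans (*-suc 4 u) (+-comm 4 (4 * u))))) (*-monoʳ-≤ 4 u<j))) (≤-trans (≤-reflexive (sym (+-identityʳ (4 * j)))) le))

≤-by : ∀ {x y} c → x + c ≡ y → x ≤ y
≤-by {x} c e = subst (x ≤_) e (m≤m+n x c)

<-by : ∀ {x y} c → suc (x + c) ≡ y → x < y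
<-by {x} c e = subst (suc x ≤_) e (s≤s (m≤m+n x c))

quot-offset : ∀ p q r s → s < 4 → 4 * p + r < 4 * q + s → Σ ℕ λ k → q ≡ p + k
quot-offset p q r s s<4 lt with ≤-<-connex p q
... | inj₁ p≤q = q ∸ p , sym (m+[n∸m]≡n p≤q)
... | inj₂ q<p = ⊥-elim (<-asym lt (≤-trans (+-monoʳ-< (4 * q) s<4) (≤-trans (≤-reflexive (sym (trans (*-suc 4 q) (+-comm 4 (4 * q))))) (≤-trans (*-monoʳ-≤ 4 q<p) (m≤m+n _ r)))))

digit-< : ∀ p r s → 4 * p + r < 4 * (p + 0) + s → r < s
digit-< p r s lt = +-cancelˡ-< (4 * p) r s (subst (λ z → 4 * p + r < 4 * z + s) (+-identityʳ p) lt)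

n≢2+n : ∀ n → n ≢ suc (suc n)
n≢2+n n e = m≢1+m+n n (trans e (cong suc (+-comm 1 n)))

⊓-cross-≤ : ∀ x y z w → x ≤ suc w → y ≤ suc z → x ⊓ y ≤ suc (z ⊓ w)
⊓-cross-≤ x y z w x≤ y≤ = ⊓-glb (≤-trans (m⊓n≤n x y) y≤) (≤-trans (m⊓n≤m x y) x≤)

neg : Letter → Letter
neg a = b
neg b = a

neg-neg : ∀ x → neg (neg x) ≡ x
neg-neg a = refl
neg-neg b = refl

neg-inj : ∀ {x y} → neg x ≡ neg y → x ≡ y
neg-inj {x} {y} e = trans (sym (neg-neg x)) (trans (cong neg e) (neg-neg y))

neg-no-fixpoint : ∀ x → neg x ≡ x → ⊥
neg-no-fixpoint a ()
neg-no-fixpoint b ()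

-- The i-th letter of a word (a default letter past its end).
nth : ℕ → List Letter → Letter
nth _ [] = a
nth zero (x ∷ _) = x
nth (suc i) (_ ∷ xs) = nth i xs

nth-++ˡ : ∀ i xs ys → i < length xs → nth i (xs ++ ys) ≡ nth i xs
nth-++ˡ zero (x ∷ xs) ys _ = refl
nth-++ˡ (suc i) (x ∷ xs) ys (s≤s p) = nth-++ˡ i xs ys p

nth-++ʳ : ∀ i xs ys → nth (length xs + i) (xs ++ ys) ≡ nth i ys
nth-++ʳ i [] ys = refl
nth-++ʳ i (x ∷ xs) ys = nth-++ʳ i xs ys

length-μ₁ : ∀ x → length (μ₁ x) ≡ 4
length-μ₁ a = refl
length-μ₁ b = refl

length-μ : ∀ L → length (μ L) ≡ 4 * length L
length-μ [] = refl
length-μ (x ∷ L) = trans (length-++ (μ₁ x)) (trans (cong₂ _+_ (length-μ₁ x) (length-μ L)) (sym (*-distribˡ-+ 4 1 (length L))))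

nth-μ : ∀ i r L → i < length L → r < 4 → nth (4 * i + r) (μ L) ≡ nth r (μ₁ (nth i L))
nth-μ zero r (x ∷ L) _ r<4 = nth-++ˡ r (μ₁ x) (μ L) (subst (r <_) (sym (length-μ₁ x)) r<4)
nth-μ (suc i) r (x ∷ L) (s≤s p) r<4 = begin
    nth (4 * suc i + r) (μ₁ x ++ μ L)
  ≡⟨ cong (λ k → nth k (μ₁ x ++ μ L)) shift ⟩
    nth (length (μ₁ x) + (4 * i + r)) (μ₁ x ++ μ L)
  ≡⟨ nth-++ʳ (4 * i + r) (μ₁ x) (μ L) ⟩
    nth (4 * i + r) (μ L)
  ≡⟨ nth-μ i r L p r<4 ⟩
    nth r (μ₁ (nth i L)) ∎
  where
  open ≡-Reasoning
  shift : 4 * suc i + r ≡ length (μ₁ x) + (4 * i + r)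
  shift = trans (cong (_+ r) (*-suc 4 i)) (trans (+-assoc 4 (4 * i) r) (cong (_+ (4 * i + r)) (sym (length-μ₁ x))))

length-μ^ : ∀ k → length (μ^ k) ≡ 4 ^ k
length-μ^ zero = refl
length-μ^ (suc k) = trans (length-μ (μ^ k)) (cong (4 *_) (length-μ^ k))

μ^-prefix : ∀ k → Σ (List Letter) λ R → μ^ (suc k) ≡ μ^ k ++ R
μ^-prefix zero = (b ∷ b ∷ a ∷ []) , refl
μ^-prefix (suc k) with μ^-prefix k
... | R , eq = μ R , trans (cong μ eq) (concatMap-++ μ₁ (μ^ k) R)

nth-μ^-stable : ∀ i k d → i < 4 ^ k → nth i (μ^ (d + k)) ≡ nth i (μ^ k)
nth-μ^-stable i k zero p = refl
nth-μ^-stable i k (suc d) p with μ^-prefix (d + k)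
... | R , eq = trans (cong (nth i) eq) (trans (nth-++ˡ i (μ^ (d + k)) R i<len) (nth-μ^-stable i k d p))
  where
  i<len : i < length (μ^ (d + k))
  i<len = subst (i <_) (sym (length-μ^ (d + k))) (<-≤-trans p (^-monoʳ-≤ 4 (m≤n+m k d)))

n<4^n : ∀ n → n < 4 ^ n
n<4^n zero = s≤s z≤n
n<4^n (suc n) = ≤-trans (s≤s (n<4^n n)) (subst (_≤ 4 ^ n + 3 * 4 ^ n) (+-comm (4 ^ n) 1) (+-monoʳ-≤ (4 ^ n) one≤))
  where
  one≤ : 1 ≤ 3 * 4 ^ n
  one≤ = ≤-trans (≤-trans (s≤s z≤n) (n<4^n n)) (m≤m+n (4 ^ n) (2 * 4 ^ n))

-- tm i is the i-th letter of the Thue–Morse word t.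
tm : ℕ → Letter
tm i = nth i (μ^ (suc i))

nth-μ^ : ∀ i k → i < 4 ^ k → nth i (μ^ k) ≡ tm i
nth-μ^ i k p with ≤-total k (suc i)
... | inj₁ k≤ = sym (trans (cong (λ e → nth i (μ^ e)) (sym (m∸n+n≡m k≤))) (nth-μ^-stable i k (suc i ∸ k) p))
... | inj₂ ≥k = trans (cong (λ e → nth i (μ^ e)) (sym (m∸n+n≡m ≥k))) (nth-μ^-stable i (suc i) (k ∸ suc i) (<-≤-trans (n<4^n i) (^-monoʳ-≤ 4 (n≤1+n i))))

tm-4i+r : ∀ i r → r < 4 → tm (4 * i + r) ≡ nth r (μ₁ (tm i))
tm-4i+r i r r<4 = trans (nth-μ i r (μ^ (4 * i + r)) i<len r<4) (cong (λ x → nth r (μ₁ x)) (nth-μ^ i (4 * i + r) i<4^))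
  where
  i<4^ : i < 4 ^ (4 * i + r)
  i<4^ = <-≤-trans (n<4^n i) (^-monoʳ-≤ 4 (≤-trans (m≤m+n i (3 * i)) (m≤m+n (4 * i) r)))
  i<len : i < length (μ^ (4 * i + r))
  i<len = subst (i <_) (sym (length-μ^ (4 * i + r))) i<4^

tm-4i : ∀ i → tm (4 * i + 0) ≡ tm i
tm-4i i = trans (tm-4i+r i 0 (s≤s z≤n)) (first (tm i))
  where
  first : ∀ x → nth 0 (μ₁ x) ≡ x
  first a = refl
  first b = refl

tm-4i+1 : ∀ i → tm (4 * i + 1) ≡ neg (tm i)
tm-4i+1 i = trans (tm-4i+r i 1 (s≤s (s≤s z≤n))) (second (tm i))
  where
  second : ∀ x → nth 1 (μ₁ x) ≡ neg x
  second a = refl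
  second b = refl

tm-4i+2 : ∀ i → tm (4 * i + 2) ≡ neg (tm i)
tm-4i+2 i = trans (tm-4i+r i 2 (s≤s (s≤s (s≤s z≤n)))) (third (tm i))
  where
  third : ∀ x → nth 2 (μ₁ x) ≡ neg x
  third a = refl
  third b = refl

tm-4i+3 : ∀ i → tm (4 * i + 3) ≡ tm i
tm-4i+3 i = trans (tm-4i+r i 3 (s≤s (s≤s (s≤s (s≤s z≤n))))) (fourth (tm i))
  where
  fourth : ∀ x → nth 3 (μ₁ x) ≡ x
  fourth a = refl
  fourth b = refl

-- μ₁ x is a palindrome: letters r and s with r + s = 3 coincide.
μ₁-palindrome : ∀ r s x → r < 4 → s < 4 → r + s ≡ 3 → nth r (μ₁ x) ≡ nth s (μ₁ x)
μ₁-palindrome 0 3 a _ _ _ = refl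
μ₁-palindrome 0 3 b _ _ _ = refl
μ₁-palindrome 1 2 a _ _ _ = refl
μ₁-palindrome 1 2 b _ _ _ = refl
μ₁-palindrome 2 1 a _ _ _ = refl
μ₁-palindrome 2 1 b _ _ _ = refl
μ₁-palindrome 3 0 a _ _ _ = refl
μ₁-palindrome 3 0 b _ _ _ = refl
μ₁-palindrome 0 0 x _ _ ()
μ₁-palindrome 0 1 x _ _ ()
μ₁-palindrome 0 2 x _ _ ()
μ₁-palindrome 1 0 x _ _ ()
μ₁-palindrome 1 1 x _ _ ()
μ₁-palindrome 1 3 x _ _ ()
μ₁-palindrome 2 0 x _ _ ()
μ₁-palindrome 2 2 x _ _ ()
μ₁-palindrome 2 3 x _ _ ()
μ₁-palindrome 3 1 x _ _ ()
μ₁-palindrome 3 2 x _ _ ()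
μ₁-palindrome 3 3 x _ _ ()
μ₁-palindrome (suc (suc (suc (suc r)))) s x (s≤s (s≤s (s≤s (s≤s ())))) _ _
μ₁-palindrome r (suc (suc (suc (suc s)))) x _ (s≤s (s≤s (s≤s (s≤s ())))) _

Binary : ℕ → Set
Binary k = (tm (2 * k) ≡ tm k) × (tm (2 * k + 1) ≡ neg (tm k))

binary : ∀ k → Binary k
binary = <-rec Binary step
  where
  four≡ : ∀ i → 4 * i + 0 ≡ 2 * (2 * i)
  four≡ = solve-∀
  four+1≡ : ∀ i → 4 * i + 1 ≡ 2 * (2 * i) + 1
  four+1≡ = solve-∀
  four+2≡ : ∀ i → 4 * i + 2 ≡ 2 * (2 * i + 1)
  four+2≡ = solve-∀
  four+3≡ : ∀ i → 4 * i + 3 ≡ 2 * (2 * i + 1) + 1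
  four+3≡ = solve-∀
  i<2i+1 : ∀ i → i < 2 * i + 1
  i<2i+1 i = subst (i <_) (+-comm 1 (2 * i)) (s≤s (m≤m+n i (i + 0)))
  even-half : ∀ i → (∀ {m} → m < 2 * i → Binary m) → tm (2 * i) ≡ tm i
  even-half zero ih = refl
  even-half (suc i) ih = proj₁ (ih (m<m+n (suc i) (s≤s z≤n)))
  step : ∀ k → (∀ {m} → m < k → Binary m) → Binary k
  step k ih with parity k
  ... | even i = trans (cong tm (sym (four≡ i))) (trans (tm-4i i) (sym half))
               , trans (cong tm (sym (four+1≡ i))) (trans (tm-4i+1 i) (cong neg (sym half)))
    where
    half : tm (2 * i) ≡ tm i
    half = even-half i ih
  ... | odd i = trans (cong tm (sym (four+2≡ i))) (trans (tm-4i+2 i) (sym half))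
              , trans (cong tm (sym (four+3≡ i))) (trans (tm-4i+3 i) (trans (sym (neg-neg (tm i))) (cong neg (sym half))))
    where
    half : tm (2 * i + 1) ≡ neg (tm i)
    half = proj₂ (ih (i<2i+1 i))

tm-2k : ∀ k → tm (2 * k) ≡ tm k
tm-2k k = proj₁ (binary k)

tm-2k+1 : ∀ k → tm (2 * k + 1) ≡ neg (tm k)
tm-2k+1 k = proj₂ (binary k)

no-three-equal : ∀ k → tm k ≡ tm (suc k) → tm (suc k) ≡ tm (suc (suc k)) → ⊥
no-three-equal k h1 h2 with parity k
... | even i = neg-no-fixpoint (tm i) (sym (trans (sym (tm-2k i)) (trans h1 (trans (cong tm (+-comm 1 (2 * i))) (tm-2k+1 i)))))
... | odd i = neg-no-fixpoint (tm (suc i)) (sym (trans (sym (tm-2k (suc i))) (trans (cong tm (sym (w2 i))) (trans h2 (trans (cong tm (w3 i)) (tm-2k+1 (suc i)))))))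
  where
  w2 : ∀ i → suc (2 * i + 1) ≡ 2 * suc i
  w2 = solve-∀
  w3 : ∀ i → suc (suc (2 * i + 1)) ≡ 2 * suc i + 1
  w3 = solve-∀

range : ℕ → ℕ → List ℕ
range j zero = []
range j (suc l) = j ∷ range (suc j) l

map-cong-range : ∀ {A : Set} (g h : ℕ → A) j l → (∀ i → j ≤ i → i < j + l → g i ≡ h i) → map g (range j l) ≡ map h (range j l)
map-cong-range g h j zero e = refl
map-cong-range g h j (suc l) e = cong₂ _∷_ (e j ≤-refl (subst (j <_) (sym (+-suc j l)) (s≤s (m≤m+n j l))))
  (map-cong-range g h (suc j) l (λ i j< i< → e i (<⇒≤ j<) (subst (i <_) (sym (+-suc j l)) i<)))

sum-at-least : ∀ {j x y} → j ≤ x → j ≤ y → x + y ≡ j + j → x ≡ j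
sum-at-least {j} {x} {y} jx jy e with m≤n⇒m<n∨m≡n jx
... | inj₂ refl = refl
... | inj₁ j<x = ⊥-elim (<⇒≢ (+-mono-<-≤ j<x jy) (sym e))

reverse-bracket : ∀ {A : Set} (x y : A) xs → reverse (x ∷ (xs ∷ʳ y)) ≡ y ∷ (reverse xs ∷ʳ x)
reverse-bracket x y xs = trans (unfold-reverse x (xs ∷ʳ y)) (cong (_∷ʳ x) (reverse-++ xs (y ∷ [])))

module Factors {A : Set} (u : ℕ → A) where

  seg : ℕ → ℕ → List A
  seg j l = map u (range j l)

  seg-++ : ∀ j l₁ l₂ → seg j (l₁ + l₂) ≡ seg j l₁ ++ seg (j + l₁) l₂
  seg-++ j zero l₂ = cong (λ e → seg e l₂) (sym (+-identityʳ j))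
  seg-++ j (suc l₁) l₂ = cong (u j ∷_) (trans (seg-++ (suc j) l₁ l₂) (cong (λ e → seg (suc j) l₁ ++ seg e l₂) (sym (+-suc j l₁))))

  []≢seg : ∀ j l → [] ≢ seg j (suc l)
  []≢seg j l ()

  seg-snoc : ∀ j l → seg j (suc l) ≡ seg j l ∷ʳ u (j + l)
  seg-snoc j l = trans (cong (seg j) (+-comm 1 l)) (seg-++ j l 1)

  seg-split : ∀ (xs ys : List A) j L → xs ++ ys ≡ seg j L →
    (length xs ≤ L) × (xs ≡ seg j (length xs)) × (ys ≡ seg (j + length xs) (L ∸ length xs))
  seg-split [] ys j L eq = z≤n , refl , trans eq (cong (λ e → seg e L) (sym (+-identityʳ j)))
  seg-split (x ∷ xs) ys j (suc L) eq with ∷-injective eq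
  ... | hx , rest with seg-split xs ys (suc j) L rest
  ... | le , q1 , q2 = s≤s le , cong₂ _∷_ hx q1 , trans q2 (cong (λ e → seg e (L ∸ length xs)) (sym (+-suc j (length xs))))

  -- u[j, m) is a palindrome, stated pointwise: symmetric positions carry equal letters.
  PalAt : ℕ → ℕ → Set
  PalAt j m = ∀ x y → j ≤ x → j ≤ y → suc (x + y) ≡ j + m → u x ≡ u y

  PalAt-shrink : ∀ {j m j′ m′} → PalAt j m → j ≤ j′ → j′ + m′ ≡ j + m → PalAt j′ m′
  PalAt-shrink p jj e x y jx jy s = p x y (≤-trans jj jx) (≤-trans jj jy) (trans s e)

  PalAt-single : ∀ j → PalAt j (suc j)
  PalAt-single j x y jx jy s = cong u (trans (sum-at-least jx jy s′) (sym (sum-at-least jy jx (trans (+-comm y x) s′))))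
    where
    s′ : x + y ≡ j + j
    s′ = cong pred (trans s (+-comm j (suc j)))

  PalAt-extend : ∀ {j m} → PalAt (suc j) m → u j ≡ u m → PalAt j (suc m)
  PalAt-extend {j} {m} p e x y jx jy s with m≤n⇒m<n∨m≡n jx | m≤n⇒m<n∨m≡n jy
  ... | inj₂ refl | _ = trans e (cong u (sym (+-cancelˡ-≡ (suc j) y m (trans s (+-suc j m)))))
  ... | inj₁ _ | inj₂ refl = trans (cong u (+-cancelˡ-≡ (suc j) x m (trans (cong suc (+-comm j x)) (trans s (+-suc j m))))) (sym e)
  ... | inj₁ jx′ | inj₁ jy′ = p x y jx′ jy′ (trans s (+-suc j m))

  private
    outer-sum : ∀ j l → suc (j + (suc j + l)) ≡ j + (j + suc (suc l))
    outer-sum = solve-∀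
    inner-sum : ∀ j l → suc j + (suc j + l) ≡ j + (j + suc (suc l))
    inner-sum = solve-∀
    bracket-end : ∀ j l → suc (suc j + l) ≡ j + suc (suc l)
    bracket-end = solve-∀

  PalAt-peel : ∀ {j l} → PalAt j (j + suc (suc l)) → (u j ≡ u (suc j + l)) × PalAt (suc j) (suc j + l)
  PalAt-peel {j} {l} p = p j (suc j + l) ≤-refl (≤-trans (n≤1+n j) (m≤m+n (suc j) l)) (outer-sum j l) ,
    PalAt-shrink p (n≤1+n j) (inner-sum j l)

  seg-bracket : ∀ j l → seg j (suc (suc l)) ≡ u j ∷ (seg (suc j) l ∷ʳ u (suc j + l))
  seg-bracket j l = cong (u j ∷_) (seg-snoc (suc j) l)

  palindrome⇒PalAt : ∀ l j → reverse (seg j l) ≡ seg j l → PalAt j (j + l)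
  palindrome⇒PalAt zero j _ x y jx jy s =
    ⊥-elim (<⇒≢ (s≤s (+-mono-≤ jx jy)) (sym (trans s (cong (_+_ j) (+-identityʳ j)))))
  palindrome⇒PalAt (suc zero) j _ = subst (PalAt j) (+-comm 1 j) (PalAt-single j)
  palindrome⇒PalAt (suc (suc l)) j r =
    subst (PalAt j) (bracket-end j l) (PalAt-extend (palindrome⇒PalAt l (suc j) inner) (sym ends))
    where
    mirrored : u (suc j + l) ∷ (reverse (seg (suc j) l) ∷ʳ u j) ≡ u j ∷ (seg (suc j) l ∷ʳ u (suc j + l))
    mirrored = trans (sym (reverse-bracket (u j) (u (suc j + l)) (seg (suc j) l)))
                     (trans (cong reverse (sym (seg-bracket j l))) (trans r (seg-bracket j l)))
    ends : u (suc j + l) ≡ u j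
    ends = proj₁ (∷-injective mirrored)
    inner : reverse (seg (suc j) l) ≡ seg (suc j) l
    inner = proj₁ (∷ʳ-injective _ _ (proj₂ (∷-injective mirrored)))

  PalAt⇒palindrome : ∀ l j → PalAt j (j + l) → reverse (seg j l) ≡ seg j l
  PalAt⇒palindrome zero j _ = refl
  PalAt⇒palindrome (suc zero) j _ = refl
  PalAt⇒palindrome (suc (suc l)) j p with PalAt-peel {j} {l} p
  ... | e , p′ = begin
      reverse (seg j (suc (suc l)))
    ≡⟨ cong reverse (seg-bracket j l) ⟩
      reverse (u j ∷ (seg (suc j) l ∷ʳ u (suc j + l)))
    ≡⟨ reverse-bracket (u j) (u (suc j + l)) (seg (suc j) l) ⟩
      u (suc j + l) ∷ (reverse (seg (suc j) l) ∷ʳ u j)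
    ≡⟨ cong₂ (λ x w → x ∷ (w ∷ʳ u j)) (sym e) (PalAt⇒palindrome l (suc j) p′) ⟩
      u j ∷ (seg (suc j) l ∷ʳ u j)
    ≡⟨ cong (λ x → u j ∷ (seg (suc j) l ∷ʳ x)) e ⟩
      u j ∷ (seg (suc j) l ∷ʳ u (suc j + l))
    ≡⟨ sym (seg-bracket j l) ⟩
      seg j (suc (suc l)) ∎
    where open ≡-Reasoning

open Factors tm public

tPrefix≡seg : ∀ n → tPrefix n ≡ seg 0 n
tPrefix≡seg n = trans (take≡nths n (μ^ n) (subst (n ≤_) (sym (length-μ^ n)) (<⇒≤ (n<4^n n))))
  (map-cong-range (λ i → nth i (μ^ n)) tm 0 n (λ i _ i< → nth-μ^ i n (<-trans i< (n<4^n n))))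
  where
  nths-shift : ∀ x L j l → map (λ i → nth i (x ∷ L)) (range (suc j) l) ≡ map (λ i → nth i L) (range j l)
  nths-shift x L j zero = refl
  nths-shift x L j (suc l) = cong (nth j L ∷_) (nths-shift x L (suc j) l)
  take≡nths : ∀ l L → l ≤ length L → take l L ≡ map (λ i → nth i L) (range 0 l)
  take≡nths zero L _ = refl
  take≡nths (suc l) (x ∷ L) (s≤s p) = cong (x ∷_) (trans (take≡nths l L p) (sym (nths-shift x L 0 l)))

private
  regroup : ∀ u v r s → suc ((4 * u + r) + (4 * v + s)) ≡ 4 * (u + v) + suc (r + s)
  regroup = solve-∀
  carry : ∀ u t → 4 * u + (4 + t) ≡ 4 * suc u + t
  carry = solve-∀

digit-sum : ∀ u v r s c → r < 4 → s < 4 → suc ((4 * u + r) + (4 * v + s)) ≡ 4 * c + 0 → (r + s ≡ 3) × (suc (u + v) ≡ c)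
digit-sum u v r s c r<4 s<4 e with suc (r + s) <? 4
... | yes t<4 = ⊥-elim (1+n≢0 (proj₂ (divMod4-unique (u + v) c (suc (r + s)) 0 t<4 (s≤s z≤n) (trans (sym (regroup u v r s)) e))))
... | no t≮4 = cong pred (trans t≡ (cong (_+_ 4) (proj₂ unique))) , proj₁ unique
  where
  t = suc (r + s) ∸ 4
  t<4 : t < 4
  t<4 = s≤s (∸-monoˡ-≤ 4 (s≤s (+-mono-≤ (≤-pred r<4) (≤-pred s<4))))
  t≡ : suc (r + s) ≡ 4 + t
  t≡ = sym (m+[n∸m]≡n (≮⇒≥ t≮4))
  unique : (suc (u + v) ≡ c) × (t ≡ 0)
  unique = divMod4-unique (suc (u + v)) c t 0 t<4 (s≤s z≤n)
    (trans (sym (carry (u + v) t)) (trans (cong (_+_ (4 * (u + v))) (sym t≡)) (trans (sym (regroup u v r s)) e)))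

private
  sum-4 : ∀ j m → (4 * j + 0) + (4 * m + 0) ≡ 4 * (j + m) + 0
  sum-4 = solve-∀

PalAt-μ : ∀ {j m} → PalAt j m → PalAt (4 * j + 0) (4 * m + 0)
PalAt-μ {j} {m} p x y jx jy s with divMod4 x | divMod4 y
... | u , r , r<4 , refl | v , s′ , s′<4 , refl with digit-sum u v r s′ (j + m) r<4 s′<4 (trans s (sum-4 j m))
... | r+s′≡3 , u+v+1≡ = begin
    tm (4 * u + r)
  ≡⟨ tm-4i+r u r r<4 ⟩
    nth r (μ₁ (tm u))
  ≡⟨ cong (λ z → nth r (μ₁ z)) (p u v (quot-mono j u r r<4 jx) (quot-mono j v s′ s′<4 jy) u+v+1≡) ⟩
    nth r (μ₁ (tm v))
  ≡⟨ μ₁-palindrome r s′ (tm v) r<4 s′<4 r+s′≡3 ⟩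
    nth s′ (μ₁ (tm v))
  ≡⟨ sym (tm-4i+r v s′ s′<4) ⟩
    tm (4 * v + s′) ∎
  where open ≡-Reasoning

private
  mirror-0-3 : ∀ x y → suc ((4 * x + 0) + (4 * y + 3)) ≡ 4 * suc (x + y)
  mirror-0-3 = solve-∀
  sum-4′ : ∀ j m → 4 * (j + m) ≡ (4 * j + 0) + (4 * m + 0)
  sum-4′ = solve-∀

PalAt-μ⁻¹ : ∀ {j m} → PalAt (4 * j + 0) (4 * m + 0) → PalAt j m
PalAt-μ⁻¹ {j} {m} p x y jx jy s =
  trans (sym (tm-4i x)) (trans (p (4 * x + 0) (4 * y + 3) le-x le-y eq) (tm-4i+3 y))
  where
  le-x : 4 * j + 0 ≤ 4 * x + 0
  le-x = +-monoˡ-≤ 0 (*-monoʳ-≤ 4 jx)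
  le-y : 4 * j + 0 ≤ 4 * y + 3
  le-y = +-mono-≤ (*-monoʳ-≤ 4 jy) z≤n
  eq : suc ((4 * x + 0) + (4 * y + 3)) ≡ (4 * j + 0) + (4 * m + 0)
  eq = trans (mirror-0-3 x y) (trans (cong (4 *_) s) (sum-4′ j m))

private
  mirror-1-2 : ∀ x y → suc ((4 * x + 1) + (4 * y + 2)) ≡ 4 * suc (x + y)
  mirror-1-2 = solve-∀
  sum-1-3 : ∀ j m → 4 * (j + suc m) ≡ (4 * j + 1) + (4 * m + 3)
  sum-1-3 = solve-∀

PalAt-contract : ∀ {j m} → PalAt (4 * j + 1) (4 * m + 3) → PalAt j (suc m)
PalAt-contract {j} {m} p x y jx jy s =
  neg-inj (trans (sym (tm-4i+1 x)) (trans (p (4 * x + 1) (4 * y + 2) le-x le-y eq) (tm-4i+2 y)))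
  where
  le-x : 4 * j + 1 ≤ 4 * x + 1
  le-x = +-monoˡ-≤ 1 (*-monoʳ-≤ 4 jx)
  le-y : 4 * j + 1 ≤ 4 * y + 2
  le-y = +-mono-≤ (*-monoʳ-≤ 4 jy) (s≤s z≤n)
  eq : suc ((4 * x + 1) + (4 * y + 2)) ≡ (4 * j + 1) + (4 * m + 3)
  eq = trans (mirror-1-2 x y) (trans (cong (4 *_) s) (sum-1-3 j m))

private
  sum-2-1 : ∀ j m → suc ((4 * j + 2) + (4 * m + 1)) ≡ (4 * j + 2) + (4 * m + 2)
  sum-2-1 = solve-∀

PalAt-widen : ∀ {j m} → j < m → PalAt (4 * j + 2) (4 * m + 2) → PalAt (4 * j + 1) (4 * m + 3)
PalAt-widen {j} {m} j<m p = subst (PalAt (4 * j + 1)) (sym (+-suc (4 * m) 2)) (PalAt-extend p′ ends)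
  where
  p′ : PalAt (suc (4 * j + 1)) (4 * m + 2)
  p′ = subst (λ z → PalAt z (4 * m + 2)) (+-suc (4 * j) 1) p
  le : 4 * j + 2 ≤ 4 * m + 1
  le = ≤-trans (+-monoʳ-≤ (4 * j) (s≤s (s≤s (z≤n {2})))) (≤-trans (≤-reflexive (sym (trans (*-suc 4 j) (+-comm 4 (4 * j))))) (≤-trans (*-monoʳ-≤ 4 j<m) (m≤m+n _ 1)))
  tj≡tm : tm j ≡ tm m
  tj≡tm = neg-inj (trans (sym (tm-4i+2 j)) (trans (p (4 * j + 2) (4 * m + 1) ≤-refl le (sum-2-1 j m)) (tm-4i+1 m)))
  ends : tm (4 * j + 1) ≡ tm (4 * m + 2)
  ends = trans (tm-4i+1 j) (trans (cong neg tj≡tm) (sym (tm-4i+2 m)))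

private
  centre-2e : ∀ e → suc (2 * e + (2 * e + 1)) ≡ 4 * e + 2
  centre-2e = solve-∀

-- No palindrome of t has its centre between positions 2e and 2e+1.
no-pal-centred-4e+2 : ∀ {j m} e → PalAt j m → j ≤ 2 * e → j + m ≡ 4 * e + 2 → ⊥
no-pal-centred-4e+2 {j} {m} e p j≤ s =
  neg-no-fixpoint (tm e) (sym (trans (sym (tm-2k e)) (trans (p (2 * e) (2 * e + 1) j≤ (≤-trans j≤ (m≤m+n _ 1)) (trans (centre-2e e) (sym s))) (tm-2k+1 e))))

-- t has no palindrome of length 5: it would force a cube in t.
no-pal-5 : ∀ d → tm (suc d) ≡ tm (d + 3) → tm d ≡ tm (d + 4) → ⊥
no-pal-5 d inner outer with parity d
... | even e = no-three-equal e A (trans (sym A) B)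
  where
  open ≡-Reasoning
  at-1 : ∀ e → 2 * e + 1 ≡ suc (2 * e)
  at-1 = solve-∀
  at-3 : ∀ e → 2 * e + 3 ≡ 2 * suc e + 1
  at-3 = solve-∀
  at-4 : ∀ e → 2 * e + 4 ≡ 2 * suc (suc e)
  at-4 = solve-∀
  A : tm e ≡ tm (suc e)
  A = neg-inj (begin
    neg (tm e)            ≡⟨ sym (tm-2k+1 e) ⟩
    tm (2 * e + 1)        ≡⟨ cong tm (at-1 e) ⟩
    tm (suc (2 * e))      ≡⟨ inner ⟩
    tm (2 * e + 3)        ≡⟨ cong tm (at-3 e) ⟩
    tm (2 * suc e + 1)    ≡⟨ tm-2k+1 (suc e) ⟩
    neg (tm (suc e))      ∎)
  B : tm e ≡ tm (suc (suc e))
  B = begin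
    tm e                  ≡⟨ sym (tm-2k e) ⟩
    tm (2 * e)            ≡⟨ outer ⟩
    tm (2 * e + 4)        ≡⟨ cong tm (at-4 e) ⟩
    tm (2 * suc (suc e))  ≡⟨ tm-2k (suc (suc e)) ⟩
    tm (suc (suc e))      ∎
... | odd e = no-three-equal e (trans B (sym A)) A
  where
  open ≡-Reasoning
  at-1 : ∀ e → 2 * suc e ≡ suc (2 * e + 1)
  at-1 = solve-∀
  at-3 : ∀ e → 2 * e + 1 + 3 ≡ 2 * suc (suc e)
  at-3 = solve-∀
  at-4 : ∀ e → 2 * e + 1 + 4 ≡ 2 * suc (suc e) + 1
  at-4 = solve-∀
  A : tm (suc e) ≡ tm (suc (suc e))
  A = begin
    tm (suc e)               ≡⟨ sym (tm-2k (suc e)) ⟩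
    tm (2 * suc e)           ≡⟨ cong tm (at-1 e) ⟩
    tm (suc (2 * e + 1))     ≡⟨ inner ⟩
    tm (2 * e + 1 + 3)       ≡⟨ cong tm (at-3 e) ⟩
    tm (2 * suc (suc e))     ≡⟨ tm-2k (suc (suc e)) ⟩
    tm (suc (suc e))         ∎
  B : tm e ≡ tm (suc (suc e))
  B = neg-inj (begin
    neg (tm e)               ≡⟨ sym (tm-2k+1 e) ⟩
    tm (2 * e + 1)           ≡⟨ outer ⟩
    tm (2 * e + 1 + 4)       ≡⟨ cong tm (at-4 e) ⟩
    tm (2 * suc (suc e) + 1) ≡⟨ tm-2k+1 (suc (suc e)) ⟩
    neg (tm (suc (suc e)))   ∎)

private
  inner-pair : ∀ d → suc (suc d + (d + 3)) ≡ 2 * d + 5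
  inner-pair = solve-∀
  outer-pair : ∀ d → suc (d + (d + 4)) ≡ 2 * d + 5
  outer-pair = solve-∀

-- Hence t has no odd palindrome of length ≥ 5: look at its five central letters.
no-long-odd-pal : ∀ {j m} d → PalAt j m → j ≤ d → j + m ≡ 2 * d + 5 → ⊥
no-long-odd-pal d p j≤d s = no-pal-5 d
  (p (suc d) (d + 3) (≤-trans j≤d (n≤1+n d)) (≤-trans j≤d (m≤m+n d 3)) (trans (inner-pair d) (sym s)))
  (p d (d + 4) j≤d (≤-trans j≤d (m≤m+n d 4)) (trans (outer-pair d) (sym s)))

private
  ends-0-2 : ∀ p → suc ((4 * p + 0) + (4 * p + 2)) ≡ (4 * p + 0) + (4 * p + 3)
  ends-0-2 = solve-∀
  ends-1-3 : ∀ p → suc ((4 * p + 1) + (4 * p + 3)) ≡ (4 * p + 1) + (4 * suc p + 0)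
  ends-1-3 = solve-∀

-- The factors t[4p, 4p+3) = x x̄ x̄ and t[4p+1, 4p+4) = x̄ x̄ x are not palindromes.
not-pal-4p : ∀ p → PalAt (4 * p + 0) (4 * p + 3) → ⊥
not-pal-4p p h = neg-no-fixpoint (tm p) (sym (trans (sym (tm-4i p)) (trans (h (4 * p + 0) (4 * p + 2) ≤-refl (+-monoʳ-≤ (4 * p) z≤n) (ends-0-2 p)) (tm-4i+2 p))))

not-pal-4p+1 : ∀ p → PalAt (4 * p + 1) (4 * suc p + 0) → ⊥
not-pal-4p+1 p h = neg-no-fixpoint (tm p) (trans (sym (tm-4i+1 p)) (trans (h (4 * p + 1) (4 * p + 3) ≤-refl (+-monoʳ-≤ (4 * p) (s≤s z≤n)) (ends-1-3 p)) (tm-4i+3 p)))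

-- The values f (4q), f (4q+1), …, f (4q+4) predicted by the recurrence,
-- in terms of x = f q and y = f (q+1).
block : ℕ → ℕ → ℕ → ℕ
block 0 x y = x
block 1 x y = suc x
block 2 x y = 2 + (x ⊓ y)
block 3 x y = suc y
block _ x y = y

data Slope : Set where
  down flat up : Slope

HasSlope : Slope → ℕ → ℕ → Set
HasSlope down x y = x ≡ suc y
HasSlope flat x y = y ≡ x
HasSlope up x y = y ≡ suc x

slope-exists : ∀ x y → y ≤ suc x → x ≤ suc y → Σ Slope λ s → HasSlope s x y
slope-exists x y y≤ x≤ with m≤n⇒m<n∨m≡n y≤
... | inj₂ y≡ = up , y≡
... | inj₁ (s≤s y≤x) with m≤n⇒m<n∨m≡n y≤x
...   | inj₂ y≡x = flat , y≡x
...   | inj₁ y<x = down , ≤-antisym x≤ y<x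

slope-unique : ∀ {s s′ x y} → HasSlope s x y → HasSlope s′ x y → s ≡ s′
slope-unique {down} {down} _ _ = refl
slope-unique {flat} {flat} _ _ = refl
slope-unique {up} {up} _ _ = refl
slope-unique {down} {flat} refl e = ⊥-elim (1+n≢n (sym e))
slope-unique {down} {up} refl e = ⊥-elim (n≢2+n _ e)
slope-unique {flat} {down} refl e = ⊥-elim (1+n≢n (sym e))
slope-unique {flat} {up} refl e = ⊥-elim (1+n≢n (sym e))
slope-unique {up} {down} refl e = ⊥-elim (n≢2+n _ e)
slope-unique {up} {flat} refl e = ⊥-elim (1+n≢n e)

-- The finite automaton read off the recurrence: the increment of f over f q
-- at position 4q+r, and the slope at 4q+r, both as functions of the slope at q.
gain : ℕ → Slope → ℕ
gain 0 _ = 0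
gain 1 _ = 1
gain 2 down = 1
gain 2 _ = 2
gain 3 down = 0
gain 3 flat = 1
gain 3 up = 2
gain _ _ = 0

next-slope : ℕ → Slope → Slope
next-slope 0 _ = up
next-slope 1 down = flat
next-slope 1 _ = up
next-slope 2 up = flat
next-slope 2 _ = down
next-slope _ _ = down

private
  min-up : ∀ x → 2 + (x ⊓ suc x) ≡ suc (suc x)
  min-up x = cong (_+_ 2) (m≤n⇒m⊓n≡m (n≤1+n x))
  min-flat : ∀ x → 2 + (x ⊓ x) ≡ suc (suc x)
  min-flat x = cong (_+_ 2) (⊓-idem x)
  min-down : ∀ y → 2 + (suc y ⊓ y) ≡ suc (suc y)
  min-down y = cong (_+_ 2) (m≥n⇒m⊓n≡n (n≤1+n y))

block-step : ∀ s x y r → r < 4 → HasSlope s x y →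
  (block r x y ≡ x + gain r s) × HasSlope (next-slope r s) (block r x y) (block (suc r) x y)
block-step up x _ 0 _ refl = sym (+-identityʳ x) , refl
block-step up x _ 1 _ refl = +-comm 1 x , min-up x
block-step up x _ 2 _ refl = trans (min-up x) (+-comm 2 x) , sym (min-up x)
block-step up x _ 3 _ refl = +-comm 2 x , refl
block-step flat x _ 0 _ refl = sym (+-identityʳ x) , refl
block-step flat x _ 1 _ refl = +-comm 1 x , min-flat x
block-step flat x _ 2 _ refl = trans (min-flat x) (+-comm 2 x) , min-flat x
block-step flat x _ 3 _ refl = +-comm 1 x , refl
block-step down _ y 0 _ refl = sym (+-identityʳ (suc y)) , refl
block-step down _ y 1 _ refl = +-comm 1 (suc y) , min-down y
block-step down _ y 2 _ refl = trans (min-down y) (+-comm 1 (suc y)) , min-down y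
block-step down _ y 3 _ refl = sym (+-identityʳ (suc y)) , refl
block-step _ _ _ (suc (suc (suc (suc _)))) (s≤s (s≤s (s≤s (s≤s ())))) _

indicator : Slope → Slope → ℤ
indicator down down = + 1
indicator flat flat = + 1
indicator up up = + 1
indicator _ _ = + 0

by-indicators : ∀ x (G : Slope → ℕ) s → + (x + G s) ≡
  (+ 1 *ℤ + x) +ℤ ((+ G down *ℤ indicator down s) +ℤ ((+ G flat *ℤ indicator flat s) +ℤ ((+ G up *ℤ indicator up s) +ℤ + 0)))
by-indicators x G down rewrite ℤ.*-identityˡ (+ x) | ℤ.*-identityʳ (+ G down) | ℤ.*-zeroʳ (+ G flat) | ℤ.*-zeroʳ (+ G up) | +-identityʳ (G down) = refl
by-indicators x G flat rewrite ℤ.*-identityˡ (+ x) | ℤ.*-zeroʳ (+ G down) | ℤ.*-identityʳ (+ G flat) | ℤ.*-zeroʳ (+ G up) | +-identityʳ (G flat) = refl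
by-indicators x G up rewrite ℤ.*-identityˡ (+ x) | ℤ.*-zeroʳ (+ G down) | ℤ.*-zeroʳ (+ G flat) | ℤ.*-identityʳ (+ G up) | +-identityʳ (G up) = refl

-- If every subsequence u (kⁱ n + r) is u n plus a function of the slope label
-- of n, then u is k-regular, generated by u and the three label indicators.
regular-by-slopes : ∀ k (u : ℕ → ℕ) (σ : ℕ → Slope) →
  (∀ i r → r < k ^ i → Σ (Slope → ℕ) λ G → ∀ n → u (k ^ i * n + r) ≡ u n + G (σ n)) →
  Regular k (λ n → + u n)
regular-by-slopes k u σ sub = 4 , generators , λ i r r< → coefficients (proj₁ (sub i r r<)) ,
  λ n → trans (cong +_ (proj₂ (sub i r r<) n)) (by-indicators (u n) (proj₁ (sub i r r<)) (σ n))
  where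
  generators : Fin 4 → ℕ → ℤ
  generators fz n = + u n
  generators (fs fz) n = indicator down (σ n)
  generators (fs (fs fz)) n = indicator flat (σ n)
  generators (fs (fs (fs fz))) n = indicator up (σ n)
  coefficients : (Slope → ℕ) → Fin 4 → ℤ
  coefficients G fz = + 1
  coefficients G (fs fz) = + G down
  coefficients G (fs (fs fz)) = + G flat
  coefficients G (fs (fs (fs fz))) = + G up

concat-snoc : ∀ {A : Set} (ws : List (List A)) w → concat (ws ∷ʳ w) ≡ concat ws ++ w
concat-snoc ws w = trans (sym (concat-++ ws (w ∷ []))) (cong (concat ws ++_) (++-identityʳ w))

length-snoc : ∀ {A : Set} (ws : List A) w → length (ws ∷ʳ w) ≡ suc (length ws)
length-snoc ws w = trans (length-++ ws) (+-comm (length ws) 1)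

module PalindromicLength (f : ℕ → ℕ) (isPPL : ∀ n → IsPPL n (f n)) where

  -- Appending the palindrome t[j, m) to an optimal factorisation of t[0, j).
  ppl-append : ∀ {j m} → j < m → PalAt j m → f m ≤ suc (f j)
  ppl-append {j} {m} j<m p with proj₁ (isPPL j)
  ... | ws , pals , conc , len = subst (λ e → f e ≤ suc (f j)) j+l≡m
        (proj₂ (isPPL (j + l)) (suc (f j)) (ws ∷ʳ w , ∷ʳ⁺ pals ((λ ()) , pal-w) , conc′ , trans (length-snoc ws w) (cong suc len)))
    where
    l = suc (m ∸ suc j)
    j+l≡m : j + l ≡ m
    j+l≡m = trans (+-suc j (m ∸ suc j)) (m+[n∸m]≡n j<m)
    w = seg j l
    pal-w : reverse w ≡ w
    pal-w = PalAt⇒palindrome l j (subst (PalAt j) (sym j+l≡m) p)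
    conc′ : concat (ws ∷ʳ w) ≡ tPrefix (j + l)
    conc′ = trans (concat-snoc ws w) (trans (cong (_++ w) (trans conc (tPrefix≡seg j)))
                  (trans (sym (seg-++ 0 j l)) (sym (tPrefix≡seg (j + l)))))

  ppl-suc : ∀ j → f (suc j) ≤ suc (f j)
  ppl-suc j = ppl-append (n<1+n j) (PalAt-single j)

  -- The last palindrome t[j, m) of an optimal factorisation of t[0, m), m > 0.
  LastPalindrome : ℕ → Set
  LastPalindrome m = Σ ℕ λ j → (j < m) × PalAt j m × (suc (f j) ≤ f m)

  ppl-last : ∀ m → 0 < m → LastPalindrome m
  ppl-last m@(suc l) _ with proj₁ (isPPL m)
  ... | ws , pals , conc , len with initLast ws
  ...   | [] = ⊥-elim ([]≢seg 0 l (trans conc (tPrefix≡seg m)))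
  ...   | ws′ ∷ʳ′ w = j , j<m , pal , fj<
    where
    pal-w : Palindrome w
    pal-w = proj₂ (∷ʳ⁻ pals)
    split = seg-split (concat ws′) w 0 m (trans (sym (concat-snoc ws′ w)) (trans conc (tPrefix≡seg m)))
    j = length (concat ws′)
    w≡ : w ≡ seg j (m ∸ j)
    w≡ = proj₂ (proj₂ split)
    j<m : j < m
    j<m with m≤n⇒m<n∨m≡n (proj₁ split)
    ... | inj₁ lt = lt
    ... | inj₂ j≡m = ⊥-elim (proj₁ pal-w (trans w≡ (cong (seg j) (trans (cong (_∸ j) (sym j≡m)) (n∸n≡0 j)))))
    pal : PalAt j m
    pal = subst (PalAt j) (m+[n∸m]≡n (proj₁ split)) (palindrome⇒PalAt (m ∸ j) j (subst (λ v → reverse v ≡ v) w≡ (proj₂ pal-w)))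
    prefix-j : PalFact j (length ws′)
    prefix-j = ws′ , proj₁ (∷ʳ⁻ pals) , trans (proj₁ (proj₂ split)) (sym (tPrefix≡seg j)) , refl
    fj< : suc (f j) ≤ f m
    fj< = subst (suc (f j) ≤_) (trans (sym (length-snoc ws′ w)) len) (s≤s (proj₂ (isPPL j) (length ws′) prefix-j))

  -- Together with ppl-suc: consecutive values of f differ by at most one.
  ppl-pred : ∀ n → f n ≤ suc (f (suc n))
  ppl-pred n with ppl-last (suc n) (s≤s z≤n)
  ... | j , s≤s j≤n , pal , fj< with m≤n⇒m<n∨m≡n j≤n
  ... | inj₂ refl = ≤-trans (n≤1+n _) (≤-trans fj< (n≤1+n _))
  ... | inj₁ j<n = ≤-trans (via (m≤n⇒m<n∨m≡n j<n)) (s≤s fj<)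
    where
    inner : PalAt (suc j) n
    inner = PalAt-shrink pal (n≤1+n j) (sym (+-suc j n))
    via : suc j < n ⊎ suc j ≡ n → f n ≤ suc (suc (f j))
    via (inj₁ lt) = ≤-trans (ppl-append lt inner) (s≤s (ppl-suc j))
    via (inj₂ refl) = ≤-trans (ppl-suc j) (n≤1+n _)

  rhs : ℕ → ℕ → ℕ
  rhs r q = block r (f q) (f (suc q))

  Upper Lower : ℕ → Set
  Upper m = ∀ q r → m ≡ 4 * q + r → r < 4 → f m ≤ rhs r q
  Lower m = ∀ q r → m ≡ 4 * q + r → r < 4 → rhs r q ≤ f m

  offset : ∀ {j p} → j < suc p → Σ ℕ λ k → p ≡ j + k
  offset {j} {p} (s≤s j≤p) = p ∸ j , sym (m+[n∸m]≡n j≤p)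

  private
    next-1 : ∀ q → suc (4 * q + 0) ≡ 4 * q + 1
    next-1 = solve-∀
    next-2 : ∀ q → suc (4 * q + 1) ≡ 4 * q + 2
    next-2 = solve-∀
    gap-0 : ∀ j k → suc (4 * j + 0 + (4 * k + 3)) ≡ 4 * suc (j + k) + 0
    gap-0 = solve-∀
    gap-2 : ∀ j k → suc (4 * j + 2 + (4 * k + 3)) ≡ 4 * (j + suc k) + 2
    gap-2 = solve-∀
    gap-3 : ∀ j k → suc (4 * j + 1 + (4 * k + 1)) ≡ 4 * (j + k) + 3
    gap-3 = solve-∀
    centre-2 : ∀ j q → (4 * j + 2) + (4 * q + 2) ≡ (4 * j + 0) + (4 * suc q + 0)
    centre-2 = solve-∀
    centre-3 : ∀ j q → (4 * j + 1) + (4 * q + 3) ≡ (4 * j + 0) + (4 * suc q + 0)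
    centre-3 = solve-∀

  -- Upper bounds: the μ-image of the last palindrome of t[0, q) or t[0, q+1),
  -- trimmed to the right length, ends an admissible factorisation of t[0, 4q+r).

  upper-0 : ∀ q → (∀ k → k < 4 * q + 0 → Upper k) → f (4 * q + 0) ≤ f q
  upper-0 zero ih = ≤-refl
  upper-0 (suc q) ih with ppl-last (suc q) (s≤s z≤n)
  ... | j , j<q , pal , fj< with offset j<q
  ... | k , refl = ≤-trans (ppl-append lt (PalAt-μ pal)) (≤-trans (s≤s (ih (4 * j + 0) lt j 0 refl 0<4)) fj<)
    where
    lt : 4 * j + 0 < 4 * suc (j + k) + 0
    lt = <-by (4 * k + 3) (gap-0 j k)

  upper-1 : ∀ q → (∀ k → k < 4 * q + 1 → Upper k) → f (4 * q + 1) ≤ suc (f q)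
  upper-1 q ih = ≤-trans (subst (λ z → f z ≤ suc (f (4 * q + 0))) (next-1 q) (ppl-suc (4 * q + 0)))
                         (s≤s (ih (4 * q + 0) (<-by 0 (trans (cong suc (+-identityʳ _)) (next-1 q))) q 0 refl 0<4))

  upper-2 : ∀ q → (∀ k → k < 4 * q + 2 → Upper k) → f (4 * q + 2) ≤ 2 + (f q ⊓ f (suc q))
  upper-2 q ih = subst (f (4 * q + 2) ≤_) (sym (+-distribˡ-⊓ 2 (f q) (f (suc q)))) (⊓-glb via-q via-q+1)
    where
    via-q : f (4 * q + 2) ≤ 2 + f q
    via-q = ≤-trans (subst (λ z → f z ≤ suc (f (4 * q + 1))) (next-2 q) (ppl-suc (4 * q + 1)))
                    (s≤s (ih (4 * q + 1) (<-by 0 (trans (cong suc (+-identityʳ _)) (next-2 q))) q 1 refl 1<4))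
    via-q+1 : f (4 * q + 2) ≤ 2 + f (suc q)
    via-q+1 with ppl-last (suc q) (s≤s z≤n)
    ... | j , j<q+1 , pal , fj< with offset j<q+1
    ... | zero , refl = ≤-trans via-q (s≤s (≤-trans (subst (λ z → suc (f z) ≤ f (suc (j + 0))) (sym (+-identityʳ j)) fj<) (n≤1+n _)))
    ... | suc k , refl = ≤-trans (ppl-append lt inner)
                           (s≤s (≤-trans (ih (4 * j + 2) lt j 2 refl 2<4) (≤-trans (+-monoʳ-≤ 2 (m⊓n≤m _ _)) (s≤s fj<))))
      where
      lt : 4 * j + 2 < 4 * (j + suc k) + 2
      lt = <-by (4 * k + 3) (gap-2 j k)
      inner : PalAt (4 * j + 2) (4 * (j + suc k) + 2)
      inner = PalAt-shrink (PalAt-μ pal) (+-monoʳ-≤ (4 * j) z≤n) (centre-2 j (j + suc k))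

  upper-3 : ∀ q → (∀ k → k < 4 * q + 3 → Upper k) → f (4 * q + 3) ≤ suc (f (suc q))
  upper-3 q ih with ppl-last (suc q) (s≤s z≤n)
  ... | j , j<q+1 , pal , fj< with offset j<q+1
  ... | k , refl = ≤-trans (ppl-append lt inner) (s≤s (≤-trans (ih (4 * j + 1) lt j 1 refl 1<4) fj<))
    where
    lt : 4 * j + 1 < 4 * (j + k) + 3
    lt = <-by (4 * k + 1) (gap-3 j k)
    inner : PalAt (4 * j + 1) (4 * (j + k) + 3)
    inner = PalAt-shrink (PalAt-μ pal) (+-monoʳ-≤ (4 * j) z≤n) (centre-3 j (j + k))

  upper : ∀ m → Upper m
  upper = <-rec Upper step
    where
    step : ∀ m → (∀ {k} → k < m → Upper k) → Upper m
    step _ ih q 0 refl _ = upper-0 q (λ k → ih {k})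
    step _ ih q 1 refl _ = upper-1 q (λ k → ih {k})
    step _ ih q 2 refl _ = upper-2 q (λ k → ih {k})
    step _ ih q 3 refl _ = upper-3 q (λ k → ih {k})
    step _ ih q (suc (suc (suc (suc _)))) refl (s≤s (s≤s (s≤s (s≤s ()))))

  -- Let t[j, 4q+r) be the last palindrome of an optimal
  -- factorisation, so f j + 1 ≤ f (4q+r).  According to j mod 4 and the offset
  -- of the quotients, either the palindrome is impossible in t (no-long-odd-pal,
  -- no-pal-centred-4e+2, not-pal-4p, not-pal-4p+1), or it comes from a
  -- palindrome ending at q or q+1 and the induction hypothesis at j applies.
  -- The facts start_rs / centre_rs are the positions of the excluded centre
  -- when j ≡ r and m ≡ s (mod 4).

  ppl-append≤ : ∀ {j m} → j ≤ m → PalAt j m → f m ≤ suc (f j)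
  ppl-append≤ j≤m pal with m≤n⇒m<n∨m≡n j≤m
  ... | inj₁ j<m = ppl-append j<m pal
  ... | inj₂ refl = n≤1+n _

  ppl-suc≤rhs₂ : ∀ p → f (suc p) ≤ 2 + (f p ⊓ f (suc p))
  ppl-suc≤rhs₂ p = subst (f (suc p) ≤_) (sym (+-distribˡ-⊓ 2 (f p) (f (suc p))))
                         (⊓-glb (≤-trans (ppl-suc p) (n≤1+n _)) (≤-trans (n≤1+n _) (n≤1+n _)))

  private
    start₁₀ : ∀ p k → 4 * p + 1 + (2 * k + 1) ≡ 4 * p + 2 * k + 2
    start₁₀ = solve-∀
    centre₁₀ : ∀ p k → 4 * p + 1 + (4 * (p + suc (suc k)) + 0) ≡ 2 * (4 * p + 2 * k + 2) + 5
    centre₁₀ = solve-∀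
    start₂₀ : ∀ p k → 4 * p + 2 + 2 * k ≡ 2 * (2 * p + k + 1)
    start₂₀ = solve-∀
    centre₂₀ : ∀ p k → 4 * p + 2 + (4 * (p + suc k) + 0) ≡ 4 * (2 * p + k + 1) + 2
    centre₂₀ = solve-∀
    start₃₀ : ∀ p k → 4 * p + 3 + 2 * k ≡ 4 * p + 2 * k + 3
    start₃₀ = solve-∀
    centre₃₀ : ∀ p k → 4 * p + 3 + (4 * (p + suc (suc k)) + 0) ≡ 2 * (4 * p + 2 * k + 3) + 5
    centre₃₀ = solve-∀

  lower-0 : ∀ q j → j < 4 * q + 0 → PalAt j (4 * q + 0) → Lower j → f q ≤ suc (f j)
  lower-0 q j lt pal low-j with mod4 j
  ... | r0 p with quot-offset p q 0 0 0<4 lt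
  ...   | zero , refl = ⊥-elim (<⇒≱ (digit-< p 0 0 lt) z≤n)
  ...   | suc k , refl = ≤-trans (ppl-append (<-by k (sym (+-suc p k))) (PalAt-μ⁻¹ pal)) (s≤s (low-j p 0 refl 0<4))
  lower-0 q j lt pal low-j | r1 p with quot-offset p q 1 0 0<4 lt
  ...   | zero , refl = ⊥-elim (<⇒≱ (digit-< p 1 0 lt) z≤n)
  ...   | suc zero , refl = ⊥-elim (not-pal-4p+1 p (subst (λ z → PalAt (4 * p + 1) (4 * z + 0)) (+-comm p 1) pal))
  ...   | suc (suc k) , refl = ⊥-elim (no-long-odd-pal (4 * p + 2 * k + 2) pal (≤-by (2 * k + 1) (start₁₀ p k)) (centre₁₀ p k))
  lower-0 q j lt pal low-j | r2 p with quot-offset p q 2 0 0<4 lt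
  ...   | zero , refl = ⊥-elim (<⇒≱ (digit-< p 2 0 lt) z≤n)
  ...   | suc k , refl = ⊥-elim (no-pal-centred-4e+2 (2 * p + k + 1) pal (≤-by (2 * k) (start₂₀ p k)) (centre₂₀ p k))
  lower-0 q j lt pal low-j | r3 p with quot-offset p q 3 0 0<4 lt
  ...   | zero , refl = ⊥-elim (<⇒≱ (digit-< p 3 0 lt) z≤n)
  ...   | suc zero , refl = subst (λ z → f z ≤ suc (f (4 * p + 3))) (sym (+-comm p 1)) (≤-trans (n≤1+n _) (≤-trans (low-j p 3 refl 3<4) (n≤1+n _)))
  ...   | suc (suc k) , refl = ⊥-elim (no-long-odd-pal (4 * p + 2 * k + 3) pal (≤-by (2 * k) (start₃₀ p k)) (centre₃₀ p k))

  private
    start₀₁ : ∀ p k → 4 * p + 0 + 2 * k ≡ 4 * p + 2 * k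
    start₀₁ = solve-∀
    centre₀₁ : ∀ p k → 4 * p + 0 + (4 * (p + suc k) + 1) ≡ 2 * (4 * p + 2 * k) + 5
    centre₀₁ = solve-∀
    start₁₁ : ∀ p k → 4 * p + 1 + (2 * k + 1) ≡ 2 * (2 * p + k + 1)
    start₁₁ = solve-∀
    centre₁₁ : ∀ p k → 4 * p + 1 + (4 * (p + suc k) + 1) ≡ 4 * (2 * p + k + 1) + 2
    centre₁₁ = solve-∀
    start₂₁ : ∀ p k → 4 * p + 2 + (2 * k + 1) ≡ 4 * p + 2 * k + 3
    start₂₁ = solve-∀
    centre₂₁ : ∀ p k → 4 * p + 2 + (4 * (p + suc (suc k)) + 1) ≡ 2 * (4 * p + 2 * k + 3) + 5
    centre₂₁ = solve-∀
    next-block : ∀ p → 4 * p + 3 + 1 ≡ 4 * suc p + 0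
    next-block = solve-∀
    same-centre : ∀ p q → (4 * suc p + 0) + (4 * q + 0) ≡ (4 * p + 3) + (4 * q + 1)
    same-centre = solve-∀

  lower-1 : ∀ q j → j < 4 * q + 1 → PalAt j (4 * q + 1) → Lower j → f q ≤ f j
  lower-1 q j lt pal low-j with mod4 j
  ... | r0 p with quot-offset p q 0 1 1<4 lt
  ...   | zero , refl = subst (λ z → f z ≤ f (4 * p + 0)) (sym (+-identityʳ p)) (low-j p 0 refl 0<4)
  ...   | suc k , refl = ⊥-elim (no-long-odd-pal (4 * p + 2 * k) pal (≤-by (2 * k) (start₀₁ p k)) (centre₀₁ p k))
  lower-1 q j lt pal low-j | r1 p with quot-offset p q 1 1 1<4 lt
  ...   | zero , refl = ⊥-elim (<⇒≱ (digit-< p 1 1 lt) ≤-refl)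
  ...   | suc k , refl = ⊥-elim (no-pal-centred-4e+2 (2 * p + k + 1) pal (≤-by (2 * k + 1) (start₁₁ p k)) (centre₁₁ p k))
  lower-1 q j lt pal low-j | r2 p with quot-offset p q 2 1 1<4 lt
  ...   | zero , refl = ⊥-elim (<⇒≱ (digit-< p 2 1 lt) (s≤s z≤n))
  ...   | suc zero , refl = subst (λ z → f z ≤ f (4 * p + 2)) (sym (+-comm p 1)) (≤-trans (ppl-suc≤rhs₂ p) (low-j p 2 refl 2<4))
  ...   | suc (suc k) , refl = ⊥-elim (no-long-odd-pal (4 * p + 2 * k + 3) pal (≤-by (2 * k + 1) (start₂₁ p k)) (centre₂₁ p k))
  lower-1 q j lt pal low-j | r3 p with quot-offset p q 3 1 1<4 lt
  ...   | zero , refl = ⊥-elim (<⇒≱ (digit-< p 3 1 lt) (s≤s z≤n))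
  ...   | suc k , refl = ≤-trans (ppl-append≤ (≤-by k (sym (+-suc p k))) inner) (low-j p 3 refl 3<4)
    where
    inner : PalAt (suc p) (p + suc k)
    inner = PalAt-μ⁻¹ (PalAt-shrink pal (≤-by 1 (next-block p)) (same-centre p (p + suc k)))

  private
    start₀₂ : ∀ p k → 4 * p + 0 + 2 * k ≡ 2 * (2 * p + k)
    start₀₂ = solve-∀
    centre₀₂ : ∀ p k → 4 * p + 0 + (4 * (p + k) + 2) ≡ 4 * (2 * p + k) + 2
    centre₀₂ = solve-∀
    start₁₂ : ∀ p k → 4 * p + 1 + 2 * k ≡ 4 * p + 2 * k + 1
    start₁₂ = solve-∀
    centre₁₂ : ∀ p k → 4 * p + 1 + (4 * (p + suc k) + 2) ≡ 2 * (4 * p + 2 * k + 1) + 5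
    centre₁₂ = solve-∀
    start₃₂ : ∀ p k → 4 * p + 3 + (2 * k + 1) ≡ 4 * p + 2 * k + 4
    start₃₂ = solve-∀
    centre₃₂ : ∀ p k → 4 * p + 3 + (4 * (p + suc (suc k)) + 2) ≡ 2 * (4 * p + 2 * k + 4) + 5
    centre₃₂ = solve-∀

  lower-2 : ∀ q j → j < 4 * q + 2 → PalAt j (4 * q + 2) → Lower j → 2 + (f q ⊓ f (suc q)) ≤ suc (f j)
  lower-2 q j lt pal low-j with mod4 j
  ... | r0 p with quot-offset p q 0 2 2<4 lt
  ...   | k , refl = ⊥-elim (no-pal-centred-4e+2 (2 * p + k) pal (≤-by (2 * k) (start₀₂ p k)) (centre₀₂ p k))
  lower-2 q j lt pal low-j | r1 p with quot-offset p q 1 2 2<4 lt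
  ...   | zero , refl = subst (λ z → 2 + (f z ⊓ f (suc z)) ≤ suc (f (4 * p + 1))) (sym (+-identityʳ p))
                          (s≤s (≤-trans (s≤s (m⊓n≤m (f p) (f (suc p)))) (low-j p 1 refl 1<4)))
  ...   | suc k , refl = ⊥-elim (no-long-odd-pal (4 * p + 2 * k + 1) pal (≤-by (2 * k) (start₁₂ p k)) (centre₁₂ p k))
  lower-2 q j lt pal low-j | r2 p with quot-offset p q 2 2 2<4 lt
  ...   | zero , refl = ⊥-elim (<⇒≱ (digit-< p 2 2 lt) ≤-refl)
  ...   | suc k , refl = s≤s (≤-trans (s≤s (⊓-cross-≤ (f q′) (f (suc q′)) (f p) (f (suc p)) to-q′ to-q′+1)) (low-j p 2 refl 2<4))
    where
    q′ = p + suc k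
    p<q : p < q′
    p<q = <-by k (sym (+-suc p k))
    -- t[4p+2, 4q′+2) widens to t[4p+1, 4q′+3), which comes from t[p, q′+1).
    pal′ : PalAt p (suc q′)
    pal′ = PalAt-contract (PalAt-widen p<q pal)
    to-q′+1 : f (suc q′) ≤ suc (f p)
    to-q′+1 = ppl-append (≤-trans p<q (n≤1+n _)) pal′
    to-q′ : f q′ ≤ suc (f (suc p))
    to-q′ = ppl-append≤ (≤-by k (sym (+-suc p k))) (PalAt-shrink pal′ (n≤1+n p) (sym (+-suc p q′)))
  lower-2 q j lt pal low-j | r3 p with quot-offset p q 3 2 2<4 lt
  ...   | zero , refl = ⊥-elim (<⇒≱ (digit-< p 3 2 lt) (s≤s (s≤s z≤n)))
  ...   | suc zero , refl = subst (λ z → 2 + (f z ⊓ f (suc z)) ≤ suc (f (4 * p + 3))) (sym (+-comm p 1))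
                          (s≤s (≤-trans (s≤s (m⊓n≤m (f (suc p)) (f (suc (suc p))))) (low-j p 3 refl 3<4)))
  ...   | suc (suc k) , refl = ⊥-elim (no-long-odd-pal (4 * p + 2 * k + 4) pal (≤-by (2 * k + 1) (start₃₂ p k)) (centre₃₂ p k))

  private
    start₀₃ : ∀ p k → 4 * p + 0 + (2 * k + 1) ≡ 4 * p + 2 * k + 1
    start₀₃ = solve-∀
    centre₀₃ : ∀ p k → 4 * p + 0 + (4 * (p + suc k) + 3) ≡ 2 * (4 * p + 2 * k + 1) + 5
    centre₀₃ = solve-∀
    start₂₃ : ∀ p k → 4 * p + 2 + 2 * k ≡ 4 * p + 2 * k + 2
    start₂₃ = solve-∀
    centre₂₃ : ∀ p k → 4 * p + 2 + (4 * (p + suc k) + 3) ≡ 2 * (4 * p + 2 * k + 2) + 5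
    centre₂₃ = solve-∀
    start₃₃ : ∀ p k → 4 * p + 3 + (2 * k + 1) ≡ 2 * (2 * p + k + 2)
    start₃₃ = solve-∀
    centre₃₃ : ∀ p k → 4 * p + 3 + (4 * (p + suc k) + 3) ≡ 4 * (2 * p + k + 2) + 2
    centre₃₃ = solve-∀

  lower-3 : ∀ q j → j < 4 * q + 3 → PalAt j (4 * q + 3) → Lower j → f (suc q) ≤ f j
  lower-3 q j lt pal low-j with mod4 j
  ... | r0 p with quot-offset p q 0 3 3<4 lt
  ...   | zero , refl = ⊥-elim (not-pal-4p p (subst (λ z → PalAt (4 * p + 0) (4 * z + 3)) (+-identityʳ p) pal))
  ...   | suc k , refl = ⊥-elim (no-long-odd-pal (4 * p + 2 * k + 1) pal (≤-by (2 * k + 1) (start₀₃ p k)) (centre₀₃ p k))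
  lower-3 q j lt pal low-j | r1 p with quot-offset p q 1 3 3<4 lt
  ...   | k , refl = ≤-trans (ppl-append (s≤s (m≤m+n p k)) (PalAt-contract pal)) (low-j p 1 refl 1<4)
  lower-3 q j lt pal low-j | r2 p with quot-offset p q 2 3 3<4 lt
  ...   | zero , refl = subst (λ z → f (suc z) ≤ f (4 * p + 2)) (sym (+-identityʳ p)) (≤-trans (ppl-suc≤rhs₂ p) (low-j p 2 refl 2<4))
  ...   | suc k , refl = ⊥-elim (no-long-odd-pal (4 * p + 2 * k + 2) pal (≤-by (2 * k) (start₂₃ p k)) (centre₂₃ p k))
  lower-3 q j lt pal low-j | r3 p with quot-offset p q 3 3 3<4 lt
  ...   | zero , refl = ⊥-elim (<⇒≱ (digit-< p 3 3 lt) ≤-refl)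
  ...   | suc k , refl = ⊥-elim (no-pal-centred-4e+2 (2 * p + k + 2) pal (≤-by (2 * k + 1) (start₃₃ p k)) (centre₃₃ p k))

  lower : ∀ m → Lower m
  lower = <-rec Lower step
    where
    step : ∀ m → (∀ {k} → k < m → Lower k) → Lower m
    step _ ih zero 0 refl _ = ≤-refl
    step m ih (suc q) 0 refl _ with ppl-last m (s≤s z≤n)
    ... | j , lt , pal , fj< = ≤-trans (lower-0 (suc q) j lt pal (ih lt)) fj<
    step m ih q 1 refl _ with ppl-last m (<-by (4 * q) (+-comm 1 (4 * q)))
    ... | j , lt , pal , fj< = ≤-trans (s≤s (lower-1 q j lt pal (ih lt))) fj<
    step m ih q 2 refl _ with ppl-last m (<-by (4 * q + 1) (sym (+-suc (4 * q) 1)))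
    ... | j , lt , pal , fj< = ≤-trans (lower-2 q j lt pal (ih lt)) fj<
    step m ih q 3 refl _ with ppl-last m (<-by (4 * q + 2) (sym (+-suc (4 * q) 2)))
    ... | j , lt , pal , fj< = ≤-trans (s≤s (lower-3 q j lt pal (ih lt))) fj<
    step _ ih q (suc (suc (suc (suc _)))) refl (s≤s (s≤s (s≤s (s≤s ()))))

  recurrence : ∀ q r → r < 4 → f (4 * q + r) ≡ rhs r q
  recurrence q r r<4 = ≤-antisym (upper _ q r refl r<4) (lower _ q r refl r<4)

  f-block : ∀ m r → r ≤ 4 → f (4 * m + r) ≡ block r (f m) (f (suc m))
  f-block m r r≤4 with m≤n⇒m<n∨m≡n r≤4
  ... | inj₁ r<4 = recurrence m r r<4
  ... | inj₂ refl = trans (cong f (next-quotient m)) (recurrence (suc m) 0 0<4)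
    where
    next-quotient : ∀ m → 4 * m + 4 ≡ 4 * suc m + 0
    next-quotient = solve-∀

  slope : ℕ → Slope
  slope n = proj₁ (slope-exists (f n) (f (suc n)) (ppl-suc n) (ppl-pred n))

  slope-spec : ∀ n → HasSlope (slope n) (f n) (f (suc n))
  slope-spec n = proj₂ (slope-exists (f n) (f (suc n)) (ppl-suc n) (ppl-pred n))

  digit-step : ∀ m r → r < 4 → (f (4 * m + r) ≡ f m + gain r (slope m)) × (slope (4 * m + r) ≡ next-slope r (slope m))
  digit-step m r r<4 with block-step (slope m) (f m) (f (suc m)) r r<4 (slope-spec m)
  ... | value , next = trans (f-block m r (<⇒≤ r<4)) value , slope-unique (slope-spec (4 * m + r)) next′
    where
    next′ : HasSlope (next-slope r (slope m)) (f (4 * m + r)) (f (suc (4 * m + r)))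
    next′ = subst₂ (HasSlope (next-slope r (slope m))) (sym (f-block m r (<⇒≤ r<4)))
                   (sym (trans (cong f (sym (+-suc (4 * m) r))) (f-block m (suc r) r<4))) next

  private
    one-times : ∀ n → 1 * n + 0 ≡ n
    one-times = solve-∀
    append-digit : ∀ Q n r′ r₀ → 4 * Q * n + (4 * r′ + r₀) ≡ 4 * (Q * n + r′) + r₀
    append-digit = solve-∀

  digits-step : ∀ i r → r < 4 ^ i → Σ (Slope → ℕ) λ G → Σ (Slope → Slope) λ Δ →
    ∀ n → (f (4 ^ i * n + r) ≡ f n + G (slope n)) × (slope (4 ^ i * n + r) ≡ Δ (slope n))
  digits-step zero zero _ = (λ _ → 0) , (λ s → s) , λ n → trans (cong f (one-times n)) (sym (+-identityʳ _)) , cong slope (one-times n)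
  digits-step zero (suc r) (s≤s ())
  digits-step (suc i) r r< with divMod4 r
  ... | r′ , r₀ , r₀<4 , refl with digits-step i r′ (*-cancelˡ-< 4 r′ (4 ^ i) (≤-<-trans (m≤m+n (4 * r′) r₀) r<))
  ... | G , Δ , H = (λ s → G s + gain r₀ (Δ s)) , (λ s → next-slope r₀ (Δ s)) , λ n →
    let e = append-digit (4 ^ i) n r′ r₀
        step = digit-step (4 ^ i * n + r′) r₀ r₀<4
    in trans (cong f e) (trans (proj₁ step) (trans (cong₂ _+_ (proj₁ (H n)) (cong (gain r₀) (proj₂ (H n)))) (+-assoc (f n) _ _))) ,
       trans (cong slope e) (trans (proj₂ step) (cong (next-slope r₀) (proj₂ (H n))))

corollary18 : (f : ℕ → ℕ) → (∀ n → IsPPL n (f n)) → Regular 4 (λ n → + f n)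
corollary18 f isPPL = regular-by-slopes 4 f slope (λ i r r< → let (G , _ , H) = digits-step i r r< in G , λ n → proj₁ (H n))
  where open PalindromicLength f isPPL
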